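{- For every positive integer $n$, $$\alpha(1,n)=\alpha(2,n)=\binom{2\lfloor\frac{n+1}{2}\rfloor}{\lfloor\frac{n+1}{2}\rfloor}.$$
   Context: For positive integers $m,n$, let $A(m,n)$ be the set of all $m\times n$ matrices with every entry in $\{1,-1\}$ such that every row sum and every column sum has absolute value at most $1$, and let $\alpha(m,n)=|A(m,n)|$. -}

module Defs where

open import Data.Nat using (ℕ; suc; _+_; _/_)
open import Data.Nat.Combinatorics using (_C_)
open import Data.Integer using (ℤ; +_; -[1+_]; ∣_∣) renaming (_+_ to _+ℤ_)
open import Data.Nat using (_≤_)
open import Data.Vec using (Vec; foldr; map; transpose)
open import Data.Vec.Relation.Unary.All using (All)
open import Data.Fin using (Fin)
open import Data.Product using (Σ)
open import Function.Bundles using (_↔_)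

data Sign : Set where
  plus minus : Sign

val : Sign → ℤ
val plus  = + 1
val minus = -[1+ 0 ]

Matrix : ℕ → ℕ → Set
Matrix m n = Vec (Vec Sign n) m

sumℤ : ∀ {k} → Vec ℤ k → ℤ
sumℤ = foldr _ _+ℤ_ (+ 0)

lineSum : ∀ {k} → Vec Sign k → ℤ
lineSum v = sumℤ (map val v)

InA : ∀ {m n} → Matrix m n → Set
InA {m} {n} M =
  All (λ r → ∣ lineSum r ∣ ≤ 1) M × All (λ c → ∣ lineSum c ∣ ≤ 1) (transpose M)
  where open import Data.Product using (_×_)

A : ℕ → ℕ → Set
A m n = Σ (Matrix m n) InA

-- α(m,n) = k  means  |A(m,n)| = k, i.e. A(m,n) is in bijection with Fin k
HasCard : Set → ℕ → Set
HasCard X k = X ↔ Fin k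

module Submission where

-- The proof reduces both to counting the
-- *balanced* sign vectors of length n, i.e. those with line sum in {-1,0,1}:
--
--   * A(1,n): a 1 × n matrix is just a row; its columns are single signs and
--     impose nothing, so A(1,n) ≅ Balanced n.
--   * A(2,n): a column (a, b) has sum of absolute value ≤ 1 iff b = -a, so the
--     second row is the negation of the first (which is balanced iff the first
--     is), and again A(2,n) ≅ Balanced n.
--
-- A sign vector with p entries +1 and q entries -1 has sum p - q, so it is
-- balanced iff p and q differ by at most one.  With p + q = n this pins p down:
-- p = h if n = 2h, and p ∈ {j, j+1} if n = 2j+1.  Vectors of length n with p
-- plus signs are counted by C(n, p) (Pascal's rule), so
-- |Balanced (2h)| = C(2h, h) and |Balanced (2j+1)| = C(2j+1, j) + C(2j+1, j+1)
-- = C(2j+2, j+1).  Finally ⌊(n+1)/2⌋ is h resp. j+1 in the two cases.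

open import Defs
open import Data.Nat using (ℕ; suc; _+_; _*_; _/_)
open import Data.Nat.Combinatorics using (_C_)
open import Data.Product using (_×_)

open import Data.Nat using (zero; _≤_; _<_; z≤n; s≤s; _%_)
open import Data.Nat.Properties
  using (≤-irrelevant; ≡-irrelevant; +-suc; +-comm; +-identityʳ; *-comm; *-suc;
         suc-injective; +-cancelˡ-≡; *-cancelˡ-≡; even≢odd; 1+n≢n; m+1+n≢0)
open import Data.Nat.DivMod using (m≡m%n+[m/n]*n; m%n<n)
open import Data.Nat.Combinatorics using (nCk+nC[k+1]≡[n+1]C[k+1])
open import Data.Integer as ℤ using (∣_∣; _⊖_) renaming (_+_ to _+ℤ_)
open import Data.Integer.Properties
  using (distribʳ-⊖-+-pos; distribʳ-⊖-+-neg; [1+m]⊖[1+n]≡m⊖n; n⊖n≡0;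
         ∣m⊖n∣≡∣n⊖m∣; neg-distrib-+; ∣-i∣≡∣i∣)
open import Data.Vec using (Vec; []; _∷_; map; transpose)
open import Data.Vec.Relation.Unary.All as All using (All; []; _∷_)
open import Data.Fin using (Fin; zero)
open import Data.Fin.Properties using (+↔⊎)
open import Data.Product using (Σ; _,_; proj₁)
open import Data.Product.Function.Dependent.Propositional using (congˡ)
open import Data.Sum using (_⊎_; inj₁; inj₂)
open import Data.Sum.Function.Propositional using (_⊎-cong_)
open import Data.Empty using (⊥-elim)
open import Function.Bundles using (_↔_; _⇔_; mk↔ₛ′; mk⇔; Equivalence)
open import Function.Properties.Inverse using (↔-trans; ↔-sym)
open import Function.Properties.Equivalence using () renaming (trans to ⇔-trans)
open import Function.Related.Propositional as Related using ()
open import Function.Related.TypeIsomorphisms using (Σ-distribˡ-⊎)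
open import Relation.Binary.PropositionalEquality
open import Relation.Nullary using (Irrelevant)


irrelevant-⇔⇒↔ : ∀ {P Q : Set} → Irrelevant P → Irrelevant Q → P ⇔ Q → P ↔ Q
irrelevant-⇔⇒↔ irrP irrQ P⇔Q = mk↔ₛ′ to from (λ q → irrQ _ q) (λ p → irrP _ p)
  where open Equivalence P⇔Q

subset-cong : ∀ {X : Set} {P Q : X → Set} →
              (∀ x → Irrelevant (P x)) → (∀ x → Irrelevant (Q x)) →
              (∀ x → P x ⇔ Q x) → Σ X P ↔ Σ X Q
subset-cong irrP irrQ P⇔Q = congˡ (λ {x} → irrelevant-⇔⇒↔ (irrP x) (irrQ x) (P⇔Q x))

pluses : ∀ {n} → Vec Sign n → ℕ
pluses []          = 0
pluses (plus ∷ v)  = suc (pluses v)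
pluses (minus ∷ v) = pluses v

minuses : ∀ {n} → Vec Sign n → ℕ
minuses []          = 0
minuses (plus ∷ v)  = minuses v
minuses (minus ∷ v) = suc (minuses v)

pluses+minuses≡length : ∀ {n} (v : Vec Sign n) → pluses v + minuses v ≡ n
pluses+minuses≡length []          = refl
pluses+minuses≡length (plus ∷ v)  = cong suc (pluses+minuses≡length v)
pluses+minuses≡length (minus ∷ v) =
  trans (+-suc (pluses v) (minuses v)) (cong suc (pluses+minuses≡length v))

lineSum≡pluses⊖minuses : ∀ {n} (v : Vec Sign n) → lineSum v ≡ pluses v ⊖ minuses v
lineSum≡pluses⊖minuses []          = refl
lineSum≡pluses⊖minuses (plus ∷ v)  =
  trans (cong (val plus +ℤ_) (lineSum≡pluses⊖minuses v)) (distribʳ-⊖-+-pos 1 (pluses v) (minuses v))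
lineSum≡pluses⊖minuses (minus ∷ v) =
  trans (cong (val minus +ℤ_) (lineSum≡pluses⊖minuses v)) (distribʳ-⊖-+-neg 0 (pluses v) (minuses v))

data Near : ℕ → ℕ → Set where
  equal : ∀ {p} → Near p p
  above : ∀ {q} → Near (suc q) q
  below : ∀ {p} → Near p (suc p)

near-suc : ∀ {p q} → Near p q → Near (suc p) (suc q)
near-suc equal = equal
near-suc above = above
near-suc below = below

∣1+n⊖n∣≡1 : ∀ n → ∣ suc n ⊖ n ∣ ≡ 1
∣1+n⊖n∣≡1 zero    = refl
∣1+n⊖n∣≡1 (suc n) = trans (cong ∣_∣ ([1+m]⊖[1+n]≡m⊖n (suc n) n)) (∣1+n⊖n∣≡1 n)

∣⊖∣≤1⇒near : ∀ p q → ∣ p ⊖ q ∣ ≤ 1 → Near p q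
∣⊖∣≤1⇒near zero          zero          _        = equal
∣⊖∣≤1⇒near zero          (suc zero)    _        = below
∣⊖∣≤1⇒near (suc zero)    zero          _        = above
∣⊖∣≤1⇒near zero          (suc (suc q)) (s≤s ())
∣⊖∣≤1⇒near (suc (suc p)) zero          (s≤s ())
∣⊖∣≤1⇒near (suc p)       (suc q)       d≤1      =
  near-suc (∣⊖∣≤1⇒near p q (subst (λ z → ∣ z ∣ ≤ 1) ([1+m]⊖[1+n]≡m⊖n p q) d≤1))

near⇒∣⊖∣≤1 : ∀ {p q} → Near p q → ∣ p ⊖ q ∣ ≤ 1
near⇒∣⊖∣≤1 {p} equal = subst (λ z → ∣ z ∣ ≤ 1) (sym (n⊖n≡0 p)) z≤n
near⇒∣⊖∣≤1 {q = q} above = subst (_≤ 1) (sym (∣1+n⊖n∣≡1 q)) (s≤s z≤n)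
near⇒∣⊖∣≤1 {p} below =
  subst (_≤ 1) (sym (trans (∣m⊖n∣≡∣n⊖m∣ p (suc p)) (∣1+n⊖n∣≡1 p))) (s≤s z≤n)

balanced⇔near : ∀ {n} (v : Vec Sign n) → (∣ lineSum v ∣ ≤ 1) ⇔ Near (pluses v) (minuses v)
balanced⇔near v rewrite lineSum≡pluses⊖minuses v =
  mk⇔ (∣⊖∣≤1⇒near (pluses v) (minuses v)) near⇒∣⊖∣≤1

double : ∀ p → 2 * p ≡ p + p
double p = cong (p +_) (+-identityʳ p)

near-even : ∀ {p q} h → p + q ≡ 2 * h → Near p q ⇔ (p ≡ h)
near-even {p} {q} h p+q≡2h = mk⇔ (to p+q≡2h) from
  where
  to : ∀ {p q} → p + q ≡ 2 * h → Near p q → p ≡ h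
  to {p} e equal = *-cancelˡ-≡ p h 2 (trans (double p) e)
  to {q = q} e above = ⊥-elim (even≢odd h q (sym (trans (cong suc (double q)) e)))
  to {p} e below =
    ⊥-elim (even≢odd h p (sym (trans (cong suc (double p)) (trans (sym (+-suc p p)) e))))
  from : p ≡ h → Near p q
  from p≡h = subst₂ Near (sym p≡h) (sym q≡h) equal
    where
    q≡h : q ≡ h
    q≡h = +-cancelˡ-≡ h q h (trans (cong (_+ q) (sym p≡h)) (trans p+q≡2h (double h)))

near-odd : ∀ {p q} j → p + q ≡ suc (2 * j) → Near p q ⇔ (p ≡ j ⊎ p ≡ suc j)
near-odd {p} {q} j p+q≡1+2j = mk⇔ (to p+q≡1+2j) from
  where
  to : ∀ {p q} → p + q ≡ suc (2 * j) → Near p q → p ≡ j ⊎ p ≡ suc j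
  to {p} e equal = ⊥-elim (even≢odd p j (trans (double p) e))
  to {q = q} e above = inj₂ (cong suc (*-cancelˡ-≡ q j 2 (trans (double q) (suc-injective e))))
  to {p} e below =
    inj₁ (*-cancelˡ-≡ p j 2 (trans (double p) (suc-injective (trans (sym (+-suc p p)) e))))
  from : p ≡ j ⊎ p ≡ suc j → Near p q
  from (inj₁ p≡j) = subst₂ Near (sym p≡j) (sym q≡1+j) below
    where
    q≡1+j : q ≡ suc j
    q≡1+j = +-cancelˡ-≡ j q (suc j) (trans (cong (_+ q) (sym p≡j))
              (trans p+q≡1+2j (trans (cong suc (double j)) (sym (+-suc j j)))))
  from (inj₂ p≡1+j) = subst₂ Near (sym p≡1+j) (sym q≡j) above
    where
    q≡j : q ≡ j
    q≡j = +-cancelˡ-≡ (suc j) q j (trans (cong (_+ q) (sym p≡1+j))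
            (trans p+q≡1+2j (cong suc (double j))))

≡-or-≡suc-irrelevant : ∀ p j → Irrelevant (p ≡ j ⊎ p ≡ suc j)
≡-or-≡suc-irrelevant p j (inj₁ a) (inj₁ b) = cong inj₁ (≡-irrelevant a b)
≡-or-≡suc-irrelevant p j (inj₂ a) (inj₂ b) = cong inj₂ (≡-irrelevant a b)
≡-or-≡suc-irrelevant p j (inj₁ a) (inj₂ b) = ⊥-elim (1+n≢n (trans (sym b) a))
≡-or-≡suc-irrelevant p j (inj₂ a) (inj₁ b) = ⊥-elim (1+n≢n (trans (sym a) b))

Balanced : ℕ → Set
Balanced n = Σ (Vec Sign n) (λ v → ∣ lineSum v ∣ ≤ 1)

WithPluses : ℕ → ℕ → Set
WithPluses n p = Σ (Vec Sign n) (λ v → pluses v ≡ p)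

balanced-even : ∀ h → Balanced (2 * h) ↔ WithPluses (2 * h) h
balanced-even h = subset-cong (λ _ → ≤-irrelevant) (λ _ → ≡-irrelevant)
  (λ v → ⇔-trans (balanced⇔near v) (near-even h (pluses+minuses≡length v)))

balanced-odd : ∀ j →
  Balanced (suc (2 * j)) ↔ (WithPluses (suc (2 * j)) j ⊎ WithPluses (suc (2 * j)) (suc j))
balanced-odd j = ↔-trans
  (subset-cong (λ _ → ≤-irrelevant) (λ v → ≡-or-≡suc-irrelevant (pluses v) j)
    (λ v → ⇔-trans (balanced⇔near v) (near-odd j (pluses+minuses≡length v))))
  Σ-distribˡ-⊎

-- Pascal's recursion on the first sign: a vector with no plus signs starts
-- with a minus, and one with p+1 plus signs starts with a plus or a minus.
withPluses-zero : ∀ n → WithPluses (suc n) 0 ↔ WithPluses n 0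
withPluses-zero n = mk↔ₛ′
  (λ { (plus ∷ v , ()) ; (minus ∷ v , e) → v , e })
  (λ { (v , e) → minus ∷ v , e })
  (λ _ → refl)
  (λ { (plus ∷ v , ()) ; (minus ∷ v , e) → refl })

withPluses-suc : ∀ n p → WithPluses (suc n) (suc p) ↔ (WithPluses n p ⊎ WithPluses n (suc p))
withPluses-suc n p = mk↔ₛ′
  (λ { (plus ∷ v , e) → inj₁ (v , suc-injective e) ; (minus ∷ v , e) → inj₂ (v , e) })
  (λ { (inj₁ (v , e)) → plus ∷ v , cong suc e ; (inj₂ (v , e)) → minus ∷ v , e })
  (λ { (inj₁ (v , e)) → cong (λ e′ → inj₁ (v , e′)) (≡-irrelevant _ _) ; (inj₂ _) → refl })
  (λ { (plus ∷ v , e) → cong (λ e′ → plus ∷ v , e′) (≡-irrelevant _ _) ; (minus ∷ v , e) → refl })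

withPluses-count : ∀ n p → WithPluses n p ↔ Fin (n C p)
withPluses-count zero zero = mk↔ₛ′ (λ _ → zero) (λ _ → [] , refl) (λ { zero → refl })
  (λ { ([] , e) → cong ([] ,_) (≡-irrelevant refl e) })
withPluses-count zero (suc p) = mk↔ₛ′ (λ { ([] , ()) }) (λ ()) (λ ()) (λ { ([] , ()) })
withPluses-count (suc n) zero = ↔-trans (withPluses-zero n) (withPluses-count n zero)
withPluses-count (suc n) (suc p) = begin
  WithPluses (suc n) (suc p)                 ↔⟨ withPluses-suc n p ⟩
  (WithPluses n p ⊎ WithPluses n (suc p))    ↔⟨ withPluses-count n p ⊎-cong withPluses-count n (suc p) ⟩
  (Fin (n C p) ⊎ Fin (n C suc p))            ↔⟨ ↔-sym +↔⊎ ⟩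
  Fin (n C p + n C suc p)                    ≡⟨ cong Fin (nCk+nC[k+1]≡[n+1]C[k+1] n p) ⟩
  Fin (suc n C suc p)                        ∎
  where open Related.EquationalReasoning

balanced-odd-count : ∀ j → Balanced (suc (2 * j)) ↔ Fin ((2 * suc j) C suc j)
balanced-odd-count j = begin
  Balanced (suc (2 * j))                              ↔⟨ balanced-odd j ⟩
  (WithPluses n j ⊎ WithPluses n (suc j))             ↔⟨ withPluses-count n j ⊎-cong withPluses-count n (suc j) ⟩
  (Fin (n C j) ⊎ Fin (n C suc j))                     ↔⟨ ↔-sym +↔⊎ ⟩
  Fin (n C j + n C suc j)                             ≡⟨ cong Fin (nCk+nC[k+1]≡[n+1]C[k+1] n j) ⟩
  Fin (suc n C suc j)                                 ≡⟨ cong (λ m → Fin (m C suc j)) (sym (*-suc 2 j)) ⟩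
  Fin ((2 * suc j) C suc j)                           ∎
  where
  open Related.EquationalReasoning
  n : ℕ
  n = suc (2 * j)

data CeilHalf : ℕ → ℕ → Set where
  even : ∀ h → CeilHalf (2 * h) h
  odd  : ∀ j → CeilHalf (suc (2 * j)) (suc j)

ceilHalf : ∀ n → CeilHalf n ((n + 1) / 2)
ceilHalf n = fromDivision ((n + 1) % 2) ((n + 1) / 2) (m%n<n (n + 1) 2) (m≡m%n+[m/n]*n (n + 1) 2)
  where
  fromDivision : ∀ r h → r < 2 → n + 1 ≡ r + h * 2 → CeilHalf n h
  fromDivision 0 zero _ n+1≡0 = ⊥-elim (m+1+n≢0 n n+1≡0)
  fromDivision 0 (suc j) _ n+1≡2+2j = subst (λ m → CeilHalf m (suc j)) (sym n≡1+2j) (odd j)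
    where
    n≡1+2j : n ≡ suc (2 * j)
    n≡1+2j = suc-injective (trans (+-comm 1 n) (trans n+1≡2+2j (cong (λ m → suc (suc m)) (*-comm j 2))))
  fromDivision 1 h _ n+1≡1+2h = subst (λ m → CeilHalf m h) (sym n≡2h) (even h)
    where
    n≡2h : n ≡ 2 * h
    n≡2h = suc-injective (trans (+-comm 1 n) (trans n+1≡1+2h (cong suc (*-comm h 2))))
  fromDivision (suc (suc r)) _ (s≤s (s≤s ())) _

balanced-count : ∀ {n h} → CeilHalf n h → Balanced n ↔ Fin ((2 * h) C h)
balanced-count (even h) = ↔-trans (balanced-even h) (withPluses-count (2 * h) h)
balanced-count (odd j)  = balanced-odd-count j

InA-irrelevant : ∀ {m n} (M : Matrix m n) → Irrelevant (InA M)
InA-irrelevant M (r , c) (r′ , c′) =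
  cong₂ _,_ (All.irrelevant ≤-irrelevant r r′) (All.irrelevant ≤-irrelevant c c′)

A-≡ : ∀ {m n} {a b : A m n} → proj₁ a ≡ proj₁ b → a ≡ b
A-≡ {a = M , p} {b = .M , q} refl = cong (M ,_) (InA-irrelevant M p q)

single-row-columns : ∀ {n} (v : Vec Sign n) → All (λ c → ∣ lineSum c ∣ ≤ 1) (transpose (v ∷ []))
single-row-columns []          = []
single-row-columns (plus ∷ v)  = s≤s z≤n ∷ single-row-columns v
single-row-columns (minus ∷ v) = s≤s z≤n ∷ single-row-columns v

A1↔Balanced : ∀ n → A 1 n ↔ Balanced n
A1↔Balanced n = mk↔ₛ′
  (λ { ((v ∷ []) , (v-bal ∷ []) , _) → v , v-bal })
  (λ { (v , v-bal) → (v ∷ []) , (v-bal ∷ []) , single-row-columns v })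
  (λ _ → refl)
  (λ { ((v ∷ []) , (_ ∷ []) , _) → A-≡ refl })

neg : Sign → Sign
neg plus  = minus
neg minus = plus

lineSum-neg : ∀ {n} (v : Vec Sign n) → lineSum (map neg v) ≡ ℤ.- lineSum v
lineSum-neg []          = refl
lineSum-neg (plus ∷ v)  =
  trans (cong (val minus +ℤ_) (lineSum-neg v)) (sym (neg-distrib-+ (val plus) (lineSum v)))
lineSum-neg (minus ∷ v) =
  trans (cong (val plus +ℤ_) (lineSum-neg v)) (sym (neg-distrib-+ (val minus) (lineSum v)))

neg-balanced : ∀ {n} (v : Vec Sign n) → ∣ lineSum v ∣ ≤ 1 → ∣ lineSum (map neg v) ∣ ≤ 1
neg-balanced v = subst (_≤ 1) (sym (trans (cong ∣_∣ (lineSum-neg v)) (∣-i∣≡∣i∣ (lineSum v))))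

-- A two-row matrix has all column sums of absolute value ≤ 1 exactly when its
-- second row is the negation of the first (a column sum is ±2 or 0).
negated-row-columns : ∀ {n} (v : Vec Sign n) →
                      All (λ c → ∣ lineSum c ∣ ≤ 1) (transpose (v ∷ map neg v ∷ []))
negated-row-columns []          = []
negated-row-columns (plus ∷ v)  = z≤n ∷ negated-row-columns v
negated-row-columns (minus ∷ v) = z≤n ∷ negated-row-columns v

second-row-negated : ∀ {n} (r s : Vec Sign n) →
                     All (λ c → ∣ lineSum c ∣ ≤ 1) (transpose (r ∷ s ∷ [])) → s ≡ map neg r
second-row-negated []          []          _          = refl
second-row-negated (plus ∷ r)  (plus ∷ s)  (s≤s () ∷ _)
second-row-negated (plus ∷ r)  (minus ∷ s) (_ ∷ cols) = cong (minus ∷_) (second-row-negated r s cols)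
second-row-negated (minus ∷ r) (plus ∷ s)  (_ ∷ cols) = cong (plus ∷_) (second-row-negated r s cols)
second-row-negated (minus ∷ r) (minus ∷ s) (s≤s () ∷ _)

A2↔Balanced : ∀ n → A 2 n ↔ Balanced n
A2↔Balanced n = mk↔ₛ′
  (λ { ((r ∷ _ ∷ []) , (r-bal ∷ _) , _) → r , r-bal })
  (λ { (v , v-bal) → (v ∷ map neg v ∷ []) , (v-bal ∷ neg-balanced v v-bal ∷ []) , negated-row-columns v })
  (λ _ → refl)
  (λ { ((r ∷ s ∷ []) , (_ ∷ _) , cols) → A-≡ (cong (λ s′ → r ∷ s′ ∷ []) (sym (second-row-negated r s cols))) })

mainTheorem11 : (k : ℕ) → let n = suc k in
    HasCard (A 1 n) ((2 * ((n + 1) / 2)) C ((n + 1) / 2))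
    × HasCard (A 2 n) ((2 * ((n + 1) / 2)) C ((n + 1) / 2))
mainTheorem11 k = ↔-trans (A1↔Balanced (suc k)) count , ↔-trans (A2↔Balanced (suc k)) count
  where
  count : Balanced (suc k) ↔ Fin ((2 * ((suc k + 1) / 2)) C ((suc k + 1) / 2))
  count = balanced-count (ceilHalf (suc k))
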